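{- (Church–Rosser property of environment-dependent reduction.) For every environment $C$ and all terms $T_0,T_1,T_2$: if $C\vdash T_0\to^* T_1$ and $C\vdash T_0\to^* T_2$, then there exists a term $T$ such that $C\vdash T_1\to^* T$ and $C\vdash T_2\to^* T$.
   Context: Terms of the calculus $\lambda\delta$ are given by the grammar $T ::= \ast h \mid x \mid \lambda x{:}W.\,T \mid \delta x{=}V.\,T \mid \mathrm{appl}(V,T) \mid \mathrm{cast}(W,T)$, where $h\in\mathbb N$ and $x$ ranges over an infinite set of variable names. Here $\ast h$ is a sort, $\lambda x{:}W.\,T$ is abstraction over type $W$, $\delta x{=}V.\,T$ is the abbreviation "let $x=V$ in $T$", $\mathrm{appl}(V,T)$ is application of the function $T$ to the argument $V$, and $\mathrm{cast}(W,T)$ is $T$ annotated with type $W$. In $\lambda x{:}W.T$ and $\delta x{=}V.T$, $x$ is bound in $T$ only; $\mathrm{FV}(T)$ is the set of free variables; terms are up to renaming of bound variables, with bound and free names disjoint. Environments are the terms generated by $E ::= \ast h \mid \lambda x{:}W.\,E \mid \delta x{=}V.\,E \mid \mathrm{appl}(V,E)\mid\mathrm{cast}(W,E)$ ($W,V$ arbitrary terms); thus an environment is a finite sequence of items terminated by a sort. We write $E=C_1\cdot\delta x{=}V\cdot C_2$ to mean that $E$ is obtained from the environment $C_1$ by replacing its terminal sort with $\delta x{=}V.\,C_2$, for some environment $C_2$ (so $E$ contains the item $\delta x{=}V$ and $C_1$ consists of the items preceding it). Strict substitution: $T[x:=^+W]\,T'$ holds iff $x\notin\mathrm{FV}(W)$,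 $x\in\mathrm{FV}(T)$, and $T'$ is obtained from $T$ by replacing a nonempty set of free occurrences of $x$ in $T$ by $W$. Environment-free parallel reduction $\to_0$ is the least relation closed under: (refl) $T\to_0T$; (compatibility) if $A_1\to_0A_2$ and $T_1\to_0T_2$ then $\lambda x{:}A_1.T_1\to_0\lambda x{:}A_2.T_2$, $\delta x{=}A_1.T_1\to_0\delta x{=}A_2.T_2$, $\mathrm{appl}(A_1,T_1)\to_0\mathrm{appl}(A_2,T_2)$, $\mathrm{cast}(A_1,T_1)\to_0\mathrm{cast}(A_2,T_2)$; ($\beta$) if $V_1\to_0V_2$, $T_1\to_0T_2$ then $\mathrm{appl}(V_1,\lambda x{:}W.T_1)\to_0\delta x{=}V_2.T_2$; ($\delta$) if $V_1\to_0V_2$, $T_1\to_0T_2$, $T_2[x:=^+V_2]\,T$ then $\delta x{=}V_1.T_1\to_0\delta x{=}V_2.T$; ($\zeta$) if $T_1\to_0T_2$, $x\notin\mathrm{FV}(T_1)$ then $\delta x{=}V.T_1\to_0T_2$; ($\tau$) if $T_1\to_0T_2$ then $\mathrm{cast}(W,T_1)\to_0T_2$; ($\upsilon$) if $V_1\to_0V_3$, $V_2\to_0V_4$, $T_1\to_0T_2$ then $\mathrm{appl}(V_1,\delta x{=}V_2.T_1)\to_0\delta x{=}V_4.\mathrm{appl}(V_3,T_2)$. Environment-dependent parallel reduction: $E\vdash T_1\to T_2$ holds iff either $T_1\to_0T_2$, or there are $C_1,C_2,x,V,T'$ with $E=C_1\cdot\delta x{=}V\cdot C_2$, $T_1\to_0T'$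 and $T'[x:=^+V]\,T_2$. $E\vdash T_1\to^*T_2$ is the transitive closure of $E\vdash\cdot\to\cdot$. -}

module Defs where

open import Data.Nat using (ℕ; zero; suc; _<ᵇ_)
open import Data.Bool using (if_then_else_)
open import Data.Product using (∃-syntax; _×_)
open import Relation.Binary.PropositionalEquality using (_≡_)
open import Relation.Nullary using (¬_)
open import Relation.Binary.Construct.Closure.Transitive using (TransClosure)

-- Terms of λδ, with de Bruijn indices (terms up to renaming of bound variables).
-- In  lam W T  and  abbr V T  the body T is under one extra binder.
data Term : Set where
  sort : ℕ → Term
  var  : ℕ → Term
  lam  : Term → Term → Term
  abbr : Term → Term → Term
  appl : Term → Term → Term
  cast : Term → Term → Term

liftVar : ℕ → ℕ → ℕ
liftVar c j = if j <ᵇ c then j else suc j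

lift : ℕ → Term → Term
lift c (sort h)   = sort h
lift c (var j)    = var (liftVar c j)
lift c (lam W T)  = lam (lift c W) (lift (suc c) T)
lift c (abbr V T) = abbr (lift c V) (lift (suc c) T)
lift c (appl V T) = appl (lift c V) (lift c T)
lift c (cast W T) = cast (lift c W) (lift c T)

liftN : ℕ → Term → Term
liftN zero    T = T
liftN (suc n) T = lift 0 (liftN n T)

data _∈FV_ : ℕ → Term → Set where
  fv-var   : ∀ {i} → i ∈FV var i
  fv-lam₁  : ∀ {i W T} → i ∈FV W → i ∈FV lam W T
  fv-lam₂  : ∀ {i W T} → suc i ∈FV T → i ∈FV lam W T
  fv-abbr₁ : ∀ {i V T} → i ∈FV V → i ∈FV abbr V T
  fv-abbr₂ : ∀ {i V T} → suc i ∈FV T → i ∈FV abbr V T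
  fv-appl₁ : ∀ {i V T} → i ∈FV V → i ∈FV appl V T
  fv-appl₂ : ∀ {i V T} → i ∈FV T → i ∈FV appl V T
  fv-cast₁ : ∀ {i W T} → i ∈FV W → i ∈FV cast W T
  fv-cast₂ : ∀ {i W T} → i ∈FV T → i ∈FV cast W T

-- Sub i W T T' : T' is obtained from T by replacing an arbitrary (possibly
-- empty) set of free occurrences of variable i by W (W lives in the same
-- context as T; it is lifted when going under binders).
data Sub : ℕ → Term → Term → Term → Set where
  s-sort : ∀ {i W h} → Sub i W (sort h) (sort h)
  s-var  : ∀ {i W j} → Sub i W (var j) (var j)
  s-hit  : ∀ {i W} → Sub i W (var i) W
  s-lam  : ∀ {i W A A' T T'} → Sub i W A A' → Sub (suc i) (lift 0 W) T T' →
           Sub i W (lam A T) (lam A' T')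
  s-abbr : ∀ {i W A A' T T'} → Sub i W A A' → Sub (suc i) (lift 0 W) T T' →
           Sub i W (abbr A T) (abbr A' T')
  s-appl : ∀ {i W A A' T T'} → Sub i W A A' → Sub i W T T' →
           Sub i W (appl A T) (appl A' T')
  s-cast : ∀ {i W A A' T T'} → Sub i W A A' → Sub i W T T' →
           Sub i W (cast A T) (cast A' T')

data Sub⁺ : ℕ → Term → Term → Term → Set where
  s⁺-hit   : ∀ {i W} → Sub⁺ i W (var i) W
  s⁺-lam₁  : ∀ {i W A A' T T'} → Sub⁺ i W A A' → Sub (suc i) (lift 0 W) T T' →
             Sub⁺ i W (lam A T) (lam A' T')
  s⁺-lam₂  : ∀ {i W A A' T T'} → Sub i W A A' → Sub⁺ (suc i) (lift 0 W) T T' →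
             Sub⁺ i W (lam A T) (lam A' T')
  s⁺-abbr₁ : ∀ {i W A A' T T'} → Sub⁺ i W A A' → Sub (suc i) (lift 0 W) T T' →
             Sub⁺ i W (abbr A T) (abbr A' T')
  s⁺-abbr₂ : ∀ {i W A A' T T'} → Sub i W A A' → Sub⁺ (suc i) (lift 0 W) T T' →
             Sub⁺ i W (abbr A T) (abbr A' T')
  s⁺-appl₁ : ∀ {i W A A' T T'} → Sub⁺ i W A A' → Sub i W T T' →
             Sub⁺ i W (appl A T) (appl A' T')
  s⁺-appl₂ : ∀ {i W A A' T T'} → Sub i W A A' → Sub⁺ i W T T' →
             Sub⁺ i W (appl A T) (appl A' T')
  s⁺-cast₁ : ∀ {i W A A' T T'} → Sub⁺ i W A A' → Sub i W T T' →
             Sub⁺ i W (cast A T) (cast A' T')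
  s⁺-cast₂ : ∀ {i W A A' T T'} → Sub i W A A' → Sub⁺ i W T T' →
             Sub⁺ i W (cast A T) (cast A' T')

StrictSubst : Term → ℕ → Term → Term → Set
StrictSubst T x W T' = ¬ (x ∈FV W) × Sub⁺ x W T T'

infix 4 _⇒₀_
data _⇒₀_ : Term → Term → Set where
  r-refl : ∀ {T} → T ⇒₀ T
  r-lam  : ∀ {A₁ A₂ T₁ T₂} → A₁ ⇒₀ A₂ → T₁ ⇒₀ T₂ → lam A₁ T₁ ⇒₀ lam A₂ T₂
  r-abbr : ∀ {A₁ A₂ T₁ T₂} → A₁ ⇒₀ A₂ → T₁ ⇒₀ T₂ → abbr A₁ T₁ ⇒₀ abbr A₂ T₂
  r-appl : ∀ {A₁ A₂ T₁ T₂} → A₁ ⇒₀ A₂ → T₁ ⇒₀ T₂ → appl A₁ T₁ ⇒₀ appl A₂ T₂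
  r-cast : ∀ {A₁ A₂ T₁ T₂} → A₁ ⇒₀ A₂ → T₁ ⇒₀ T₂ → cast A₁ T₁ ⇒₀ cast A₂ T₂
  r-β    : ∀ {V₁ V₂ W T₁ T₂} → V₁ ⇒₀ V₂ → T₁ ⇒₀ T₂ →
           appl V₁ (lam W T₁) ⇒₀ abbr V₂ T₂
  -- (δ) δx=V₁.T₁ → δx=V₂.T  where T₂[x:=⁺V₂]T  (x is index 0 under the binder)
  r-δ    : ∀ {V₁ V₂ T₁ T₂ T} → V₁ ⇒₀ V₂ → T₁ ⇒₀ T₂ →
           StrictSubst T₂ 0 (lift 0 V₂) T →
           abbr V₁ T₁ ⇒₀ abbr V₂ T
  -- (ζ) δx=V.T₁ → T₂  when x ∉ FV(T₁)  (i.e. the body is a weakening lift 0 U₁)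
  r-ζ    : ∀ {V U₁ U₂} → U₁ ⇒₀ U₂ → abbr V (lift 0 U₁) ⇒₀ U₂
  r-τ    : ∀ {W T₁ T₂} → T₁ ⇒₀ T₂ → cast W T₁ ⇒₀ T₂
  r-υ    : ∀ {V₁ V₂ V₃ V₄ T₁ T₂} → V₁ ⇒₀ V₃ → V₂ ⇒₀ V₄ → T₁ ⇒₀ T₂ →
           appl V₁ (abbr V₂ T₁) ⇒₀ abbr V₄ (appl (lift 0 V₃) T₂)

-- Environments: finite sequences of items terminated by a sort
-- (first constructor argument = outermost item).
data Env : Set where
  e-sort : ℕ → Env
  e-lam  : Term → Env → Env
  e-abbr : Term → Env → Env
  e-appl : Term → Env → Env
  e-cast : Term → Env → Env

_·δ_·_ : Env → Term → Env → Env
e-sort h   ·δ V · C₂ = e-abbr V C₂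
e-lam W C  ·δ V · C₂ = e-lam W (C ·δ V · C₂)
e-abbr W C ·δ V · C₂ = e-abbr W (C ·δ V · C₂)
e-appl W C ·δ V · C₂ = e-appl W (C ·δ V · C₂)
e-cast W C ·δ V · C₂ = e-cast W (C ·δ V · C₂)

binders : Env → ℕ
binders (e-sort h)   = 0
binders (e-lam W C)  = suc (binders C)
binders (e-abbr V C) = suc (binders C)
binders (e-appl V C) = binders C
binders (e-cast W C) = binders C

-- Terms reduced in E live in the scope of all binders of E. For
-- E = C₁·δx=V·C₂, the variable x has index  binders C₂  and the value V
-- (which lives in the scope of C₁) is weakened past x and the binders of C₂.
infix 4 _⊢_⇒_
_⊢_⇒_ : Env → Term → Term → Set
E ⊢ T₁ ⇒ T₂ =
  (T₁ ⇒₀ T₂) ⊎′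
  (∃[ C₁ ] ∃[ C₂ ] ∃[ V ] ∃[ T' ]
     (E ≡ (C₁ ·δ V · C₂)) × (T₁ ⇒₀ T') ×
     StrictSubst T' (binders C₂) (liftN (suc (binders C₂)) V) T₂)
  where open import Data.Sum using () renaming (_⊎_ to _⊎′_)

infix 4 _⊢_⇒*_
_⊢_⇒*_ : Env → Term → Term → Set
E ⊢ T₁ ⇒* T₂ = TransClosure (E ⊢_⇒_) T₁ T₂

module Submission where

-- Tait–Martin-Löf's method.  Let Γ ⊢ T ⇛ T′ be the parallel reduction that
-- simultaneously contracts β-, ζ-, τ- and υ-redexes and replaces variables
-- bound to a value (by the context Γ or by a δ inside T) with that value.  In
-- the context of an environment C, the steps C ⊢ T → T′ and the steps ⇛ have
-- the same transitive closure, so it suffices that ⇛ has the diamond property.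
-- That follows from Takahashi's triangle: every T has a complete development
-- T* (contract every redex, preferring ζ wherever it applies, and unfold every
-- abbreviated variable) such that S ⇛ T* whenever T ⇛ S.

open import Defs
open import Data.Product using (∃-syntax; _×_; _,_)

open import Data.Bool using (true; false)
open import Data.Empty using (⊥-elim)
open import Data.List using (List; []; _∷_; length)
import Data.List as List
open import Data.List.Properties using (length-++)
open import Data.Maybe using (Maybe; just; nothing)
import Data.Maybe as Maybe
open import Data.Nat using (ℕ; zero; suc; _≤_; z≤n; s≤s; _<ᵇ_; _≟_)
open import Data.Nat.Properties using (suc-injective; +-comm)
open import Data.Sum using (_⊎_; inj₁; inj₂; [_,_]′)
open import Function using (_∘_; id)
open import Level using (_⊔_)
open import Relation.Binary.Core using (Rel; _⇒_; _=[_]⇒_)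
open import Relation.Binary.Construct.Closure.Transitive
  using (TransClosure; [_]; _∷_; _∷ʳ_; _++_)
open import Relation.Binary.PropositionalEquality
  using (_≡_; _≢_; refl; sym; trans; cong; cong₂; subst)
open import Relation.Nullary using (¬_; Dec; yes; no)
open import Relation.Nullary.Decidable using (map′; _⊎-dec_)

Diamond : ∀ {a ℓ} {I : Set a} → Rel I ℓ → Set (a ⊔ ℓ)
Diamond _∼_ = ∀ {x y z} → x ∼ y → x ∼ z → ∃[ w ] (y ∼ w × z ∼ w)

map⁺ : ∀ {a b ℓ₁ ℓ₂} {I : Set a} {J : Set b} {R : Rel I ℓ₁} {S : Rel J ℓ₂} (f : I → J) →
       R =[ f ]⇒ S → TransClosure R =[ f ]⇒ TransClosure S
map⁺ f g [ r ]    = [ g r ]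
map⁺ f g (r ∷ rs) = g r ∷ map⁺ f g rs

cong₂⁺ : ∀ {a b c ℓ₁ ℓ₂ ℓ₃} {I : Set a} {J : Set b} {K : Set c}
         {R : Rel I ℓ₁} {S : I → Rel J ℓ₂} {T : Rel K ℓ₃} (f : I → J → K) →
         (∀ {x x′ y} → R x x′ → T (f x y) (f x′ y)) →
         (∀ {x y y′} → S x y y′ → T (f x y) (f x y′)) →
         ∀ {x x′ y y′} → TransClosure R x x′ → TransClosure (S x′) y y′ →
         TransClosure T (f x y) (f x′ y′)
cong₂⁺ f left right rs ss = map⁺ (λ x → f x _) left rs ++ map⁺ (f _) right ss

module _ {a ℓ₁ ℓ₂} {I : Set a} {R : Rel I ℓ₁} {S : Rel I ℓ₂} where

  concatMap⁺ : R ⇒ TransClosure S → TransClosure R ⇒ TransClosure S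
  concatMap⁺ g [ r ]    = g r
  concatMap⁺ g (r ∷ rs) = g r ++ concatMap⁺ g rs

module _ {a ℓ} {I : Set a} {R : Rel I ℓ} where

  strip : Diamond R → ∀ {x y z} → R x y → TransClosure R x z →
          ∃[ w ] (TransClosure R y w × R z w)
  strip ◇ r [ s ] with w , r′ , s′ ← ◇ r s = w , [ r′ ] , s′
  strip ◇ r (s ∷ ss) with _ , r′ , s′ ← ◇ r s with w , t , u ← strip ◇ s′ ss =
    w , r′ ∷ t , u

  diamond⁺ : Diamond R → Diamond (TransClosure R)
  diamond⁺ ◇ [ r ] ss with w , t , u ← strip ◇ r ss = w , t , [ u ]
  diamond⁺ ◇ (r ∷ rs) ss with _ , t , u ← strip ◇ r ss with w , t′ , u′ ← diamond⁺ ◇ rs t =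
    w , t′ , u ∷ u′

diamond⁺-transfer : ∀ {a ℓ₁ ℓ₂} {I : Set a} {R : Rel I ℓ₁} {S : Rel I ℓ₂} →
                    R ⇒ TransClosure S → S ⇒ TransClosure R →
                    Diamond S → Diamond (TransClosure R)
diamond⁺-transfer R⊆S⁺ S⊆R⁺ ◇ r₁ r₂
  with w , s₁ , s₂ ← diamond⁺ ◇ (concatMap⁺ R⊆S⁺ r₁) (concatMap⁺ R⊆S⁺ r₂)
  = w , concatMap⁺ S⊆R⁺ s₁ , concatMap⁺ S⊆R⁺ s₂

private variable
  c d h i j k u x : ℕ
  A A′ B B′ T T′ T₁ T₂ U U′ V V′ V₁ V₂ V₃ V₄ W X Y Z : Term
  A* B* T* U* V* W* : Term

liftVar-suc : ∀ c j → liftVar (suc c) (suc j) ≡ suc (liftVar c j)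
liftVar-suc c j with j <ᵇ c
... | true  = refl
... | false = refl

liftVar-comm : d ≤ c → ∀ j → liftVar (suc c) (liftVar d j) ≡ liftVar d (liftVar c j)
liftVar-comm {c = c} z≤n j = liftVar-suc c j
liftVar-comm (s≤s _) zero = refl
liftVar-comm {suc d} {suc c} (s≤s d≤c) (suc j)
  rewrite liftVar-suc d j | liftVar-suc c j
        | liftVar-suc (suc c) (liftVar d j) | liftVar-suc d (liftVar c j)
  = cong suc (liftVar-comm d≤c j)

liftVar-pullback : d ≤ c → liftVar (suc c) x ≡ liftVar d u →
                   ∃[ w ] (x ≡ liftVar d w × u ≡ liftVar c w)
liftVar-pullback {x = zero} z≤n ()
liftVar-pullback {c = c} {x = suc x} z≤n eq =
  x , refl , suc-injective (trans (sym eq) (liftVar-suc c x))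
liftVar-pullback {x = zero} {zero} (s≤s _) eq = zero , refl , refl
liftVar-pullback {d = suc d} {x = zero} {suc u} (s≤s _) eq
  rewrite liftVar-suc d u with () ← eq
liftVar-pullback {c = suc c} {x = suc x} {zero} (s≤s _) eq
  rewrite liftVar-suc (suc c) x with () ← eq
liftVar-pullback {suc d} {suc c} {suc x} {suc u} (s≤s d≤c) eq
  rewrite liftVar-suc (suc c) x | liftVar-suc d u
  with w , refl , refl ← liftVar-pullback {x = x} {u} d≤c (suc-injective eq)
  = suc w , sym (liftVar-suc d w) , sym (liftVar-suc c w)

liftVar-injective : ∀ c → liftVar c i ≡ liftVar c j → i ≡ j
liftVar-injective zero eq = suc-injective eq
liftVar-injective {zero} {zero} (suc c) eq = refl
liftVar-injective {zero} {suc j} (suc c) eq rewrite liftVar-suc c j with () ← eq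
liftVar-injective {suc i} {zero} (suc c) eq rewrite liftVar-suc c i with () ← eq
liftVar-injective {suc i} {suc j} (suc c) eq rewrite liftVar-suc c i | liftVar-suc c j =
  cong suc (liftVar-injective c (suc-injective eq))

liftVar≢cutoff : ∀ c j → liftVar c j ≢ c
liftVar≢cutoff (suc c) zero ()
liftVar≢cutoff (suc c) (suc j) eq rewrite liftVar-suc c j =
  liftVar≢cutoff c j (suc-injective eq)

liftVar-surjective : j ≢ c → ∃[ u ] (liftVar c u ≡ j)
liftVar-surjective {zero} {zero} j≢c = ⊥-elim (j≢c refl)
liftVar-surjective {suc j} {zero} j≢c = j , refl
liftVar-surjective {zero} {suc c} j≢c = zero , refl
liftVar-surjective {suc j} {suc c} j≢c
  with u , refl ← liftVar-surjective {j} {c} (j≢c ∘ cong suc)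
  = suc u , liftVar-suc c u

-- The immediate subterms of a binary term former (junk on sorts and variables):
-- `cong child₁` and `cong child₂` invert all four binary constructors at once.
child₁ child₂ : Term → Term
child₁ (lam A B)  = A
child₁ (abbr A B) = A
child₁ (appl A B) = A
child₁ (cast A B) = A
child₁ T          = T
child₂ (lam A B)  = B
child₂ (abbr A B) = B
child₂ (appl A B) = B
child₂ (cast A B) = B
child₂ T          = T

var-injective : var i ≡ var j → i ≡ j
var-injective refl = refl

lift-comm : d ≤ c → ∀ X → lift (suc c) (lift d X) ≡ lift d (lift c X)
lift-comm d≤c (sort h)   = refl
lift-comm d≤c (var j)    = cong var (liftVar-comm d≤c j)
lift-comm d≤c (lam A B)  = cong₂ lam (lift-comm d≤c A) (lift-comm (s≤s d≤c) B)
lift-comm d≤c (abbr A B) = cong₂ abbr (lift-comm d≤c A) (lift-comm (s≤s d≤c) B)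
lift-comm d≤c (appl A B) = cong₂ appl (lift-comm d≤c A) (lift-comm d≤c B)
lift-comm d≤c (cast A B) = cong₂ cast (lift-comm d≤c A) (lift-comm d≤c B)

lift-comm₀ : ∀ c X → lift (suc c) (lift 0 X) ≡ lift 0 (lift c X)
lift-comm₀ c = lift-comm z≤n

lift-injective : ∀ c X Y → lift c X ≡ lift c Y → X ≡ Y
lift-injective c (sort h) (sort h) refl = refl
lift-injective c (var i) (var j) eq = cong var (liftVar-injective c (var-injective eq))
lift-injective c (lam A B) (lam A′ B′) eq = cong₂ lam
  (lift-injective c A A′ (cong child₁ eq)) (lift-injective (suc c) B B′ (cong child₂ eq))
lift-injective c (abbr A B) (abbr A′ B′) eq = cong₂ abbr
  (lift-injective c A A′ (cong child₁ eq)) (lift-injective (suc c) B B′ (cong child₂ eq))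
lift-injective c (appl A B) (appl A′ B′) eq = cong₂ appl
  (lift-injective c A A′ (cong child₁ eq)) (lift-injective c B B′ (cong child₂ eq))
lift-injective c (cast A B) (cast A′ B′) eq = cong₂ cast
  (lift-injective c A A′ (cong child₁ eq)) (lift-injective c B B′ (cong child₂ eq))

lift-pullback : d ≤ c → ∀ X U → lift (suc c) X ≡ lift d U →
                ∃[ Z ] (X ≡ lift d Z × U ≡ lift c Z)
lift-pullback d≤c (sort h) (sort h) refl = sort h , refl , refl
lift-pullback d≤c (var x) (var u) eq
  with w , refl , refl ← liftVar-pullback {x = x} {u} d≤c (var-injective eq)
  = var w , refl , refl
lift-pullback d≤c (lam A B) (lam A′ B′) eq
  with Z₁ , refl , refl ← lift-pullback d≤c A A′ (cong child₁ eq)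
     | Z₂ , refl , refl ← lift-pullback (s≤s d≤c) B B′ (cong child₂ eq)
  = lam Z₁ Z₂ , refl , refl
lift-pullback d≤c (abbr A B) (abbr A′ B′) eq
  with Z₁ , refl , refl ← lift-pullback d≤c A A′ (cong child₁ eq)
     | Z₂ , refl , refl ← lift-pullback (s≤s d≤c) B B′ (cong child₂ eq)
  = abbr Z₁ Z₂ , refl , refl
lift-pullback d≤c (appl A B) (appl A′ B′) eq
  with Z₁ , refl , refl ← lift-pullback d≤c A A′ (cong child₁ eq)
     | Z₂ , refl , refl ← lift-pullback d≤c B B′ (cong child₂ eq)
  = appl Z₁ Z₂ , refl , refl
lift-pullback d≤c (cast A B) (cast A′ B′) eq
  with Z₁ , refl , refl ← lift-pullback d≤c A A′ (cong child₁ eq)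
     | Z₂ , refl , refl ← lift-pullback d≤c B B′ (cong child₂ eq)
  = cast Z₁ Z₂ , refl , refl

∈FV-lift : ∀ c X → i ∈FV lift c X → ∃[ j ] (j ∈FV X × i ≡ liftVar c j)
∈FV-lift c (var j) fv-var = j , fv-var , refl
∈FV-lift c (lam A B)  (fv-lam₁ p)  with j , q , refl ← ∈FV-lift c A p = j , fv-lam₁ q , refl
∈FV-lift c (lam A B)  (fv-lam₂ p)  with suc j , q , eq ← ∈FV-lift (suc c) B p =
  j , fv-lam₂ q , suc-injective (trans eq (liftVar-suc c j))
∈FV-lift c (abbr A B) (fv-abbr₁ p) with j , q , refl ← ∈FV-lift c A p = j , fv-abbr₁ q , refl
∈FV-lift c (abbr A B) (fv-abbr₂ p) with suc j , q , eq ← ∈FV-lift (suc c) B p =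
  j , fv-abbr₂ q , suc-injective (trans eq (liftVar-suc c j))
∈FV-lift c (appl A B) (fv-appl₁ p) with j , q , refl ← ∈FV-lift c A p = j , fv-appl₁ q , refl
∈FV-lift c (appl A B) (fv-appl₂ p) with j , q , refl ← ∈FV-lift c B p = j , fv-appl₂ q , refl
∈FV-lift c (cast A B) (fv-cast₁ p) with j , q , refl ← ∈FV-lift c A p = j , fv-cast₁ q , refl
∈FV-lift c (cast A B) (fv-cast₂ p) with j , q , refl ← ∈FV-lift c B p = j , fv-cast₂ q , refl

cutoff∉FV-lift : ∀ c X → ¬ c ∈FV lift c X
cutoff∉FV-lift c X p with j , _ , eq ← ∈FV-lift c X p = liftVar≢cutoff c j (sym eq)

∉FV-liftN : ∀ k W → ¬ k ∈FV liftN (suc k) W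
∉FV-liftN zero    W = cutoff∉FV-lift 0 W
∉FV-liftN (suc k) W p with j , q , eq ← ∈FV-lift 0 (liftN (suc k) W) p
  rewrite suc-injective eq = ∉FV-liftN j W q

_∈FV?_ : ∀ i T → Dec (i ∈FV T)
i ∈FV? sort h = no λ ()
i ∈FV? var j with i ≟ j
... | yes refl = yes fv-var
... | no i≢j   = no λ { fv-var → i≢j refl }
i ∈FV? lam A B  = map′ [ fv-lam₁ , fv-lam₂ ]′
  (λ { (fv-lam₁ p) → inj₁ p ; (fv-lam₂ p) → inj₂ p }) (i ∈FV? A ⊎-dec suc i ∈FV? B)
i ∈FV? abbr A B = map′ [ fv-abbr₁ , fv-abbr₂ ]′
  (λ { (fv-abbr₁ p) → inj₁ p ; (fv-abbr₂ p) → inj₂ p }) (i ∈FV? A ⊎-dec suc i ∈FV? B)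
i ∈FV? appl A B = map′ [ fv-appl₁ , fv-appl₂ ]′
  (λ { (fv-appl₁ p) → inj₁ p ; (fv-appl₂ p) → inj₂ p }) (i ∈FV? A ⊎-dec i ∈FV? B)
i ∈FV? cast A B = map′ [ fv-cast₁ , fv-cast₂ ]′
  (λ { (fv-cast₁ p) → inj₁ p ; (fv-cast₂ p) → inj₂ p }) (i ∈FV? A ⊎-dec i ∈FV? B)

IsLift : ℕ → Term → Set
IsLift c B = ∃[ U ] (B ≡ lift c U)

∉FV⇒isLift : ∀ c B → ¬ c ∈FV B → IsLift c B
∉FV⇒isLift c (sort h) c∉ = sort h , refl
∉FV⇒isLift c (var j) c∉ with u , refl ← liftVar-surjective {j} {c} (λ { refl → c∉ fv-var }) =
  var u , refl
∉FV⇒isLift c (lam A B) c∉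
  with U₁ , refl ← ∉FV⇒isLift c A (c∉ ∘ fv-lam₁) | U₂ , refl ← ∉FV⇒isLift (suc c) B (c∉ ∘ fv-lam₂)
  = lam U₁ U₂ , refl
∉FV⇒isLift c (abbr A B) c∉
  with U₁ , refl ← ∉FV⇒isLift c A (c∉ ∘ fv-abbr₁) | U₂ , refl ← ∉FV⇒isLift (suc c) B (c∉ ∘ fv-abbr₂)
  = abbr U₁ U₂ , refl
∉FV⇒isLift c (appl A B) c∉
  with U₁ , refl ← ∉FV⇒isLift c A (c∉ ∘ fv-appl₁) | U₂ , refl ← ∉FV⇒isLift c B (c∉ ∘ fv-appl₂)
  = appl U₁ U₂ , refl
∉FV⇒isLift c (cast A B) c∉
  with U₁ , refl ← ∉FV⇒isLift c A (c∉ ∘ fv-cast₁) | U₂ , refl ← ∉FV⇒isLift c B (c∉ ∘ fv-cast₂)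
  = cast U₁ U₂ , refl

isLift? : ∀ c B → Dec (IsLift c B)
isLift? c B with c ∈FV? B
... | yes c∈B = no λ { (U , refl) → cutoff∉FV-lift c U c∈B }
... | no  c∉B = yes (∉FV⇒isLift c B c∉B)

-- A context lists the binders in scope, innermost first: `just V` for an
-- abbreviation δx=V (V lives in the scope of the binders after it), `nothing`
-- for any other binder.
Ctx : Set
Ctx = List (Maybe Term)

private variable
  Γ Γ′ Δ : Ctx
  e : Maybe Term

infix 4 _∋_↦_
data _∋_↦_ : Ctx → ℕ → Term → Set where
  here  : just V ∷ Γ ∋ zero ↦ V
  there : Γ ∋ k ↦ V → e ∷ Γ ∋ suc k ↦ V

-- ⇛-ζ states its side condition as an equation so that ⇛-strengthen can
-- match it against a lifted term.
infix 4 _⊢_⇛_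
data _⊢_⇛_ (Γ : Ctx) : Term → Term → Set where
  ⇛-sort   : Γ ⊢ sort h ⇛ sort h
  ⇛-var    : Γ ⊢ var k ⇛ var k
  ⇛-unfold : Γ ∋ k ↦ V → Γ ⊢ var k ⇛ liftN (suc k) V
  ⇛-lam    : Γ ⊢ A ⇛ A′ → nothing ∷ Γ ⊢ B ⇛ B′ → Γ ⊢ lam A B ⇛ lam A′ B′
  ⇛-abbr   : Γ ⊢ A ⇛ A′ → just A′ ∷ Γ ⊢ B ⇛ B′ → Γ ⊢ abbr A B ⇛ abbr A′ B′
  ⇛-appl   : Γ ⊢ A ⇛ A′ → Γ ⊢ B ⇛ B′ → Γ ⊢ appl A B ⇛ appl A′ B′
  ⇛-cast   : Γ ⊢ A ⇛ A′ → Γ ⊢ B ⇛ B′ → Γ ⊢ cast A B ⇛ cast A′ B′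
  ⇛-β      : Γ ⊢ V ⇛ V′ → nothing ∷ Γ ⊢ B ⇛ B′ → Γ ⊢ appl V (lam W B) ⇛ abbr V′ B′
  ⇛-ζ      : B ≡ lift 0 U → Γ ⊢ U ⇛ U′ → Γ ⊢ abbr V B ⇛ U′
  ⇛-τ      : Γ ⊢ T ⇛ T′ → Γ ⊢ cast W T ⇛ T′
  ⇛-υ      : Γ ⊢ V₁ ⇛ V₃ → Γ ⊢ V₂ ⇛ V₄ → just V₄ ∷ Γ ⊢ T₁ ⇛ T₂ →
             Γ ⊢ appl V₁ (abbr V₂ T₁) ⇛ abbr V₄ (appl (lift 0 V₃) T₂)

⇛-refl : Γ ⊢ T ⇛ T
⇛-refl {T = sort h}   = ⇛-sort
⇛-refl {T = var k}    = ⇛-var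
⇛-refl {T = lam A B}  = ⇛-lam ⇛-refl ⇛-refl
⇛-refl {T = abbr A B} = ⇛-abbr ⇛-refl ⇛-refl
⇛-refl {T = appl A B} = ⇛-appl ⇛-refl ⇛-refl
⇛-refl {T = cast A B} = ⇛-cast ⇛-refl ⇛-refl

data Insert : ℕ → Ctx → Ctx → Set where
  insert-here  : Insert zero Γ (e ∷ Γ)
  insert-under : Insert c Γ Γ′ → Insert (suc c) (e ∷ Γ) (Maybe.map (lift c) e ∷ Γ′)

∋-weaken : Insert c Γ Γ′ → Γ ∋ k ↦ V →
           ∃[ V′ ] (Γ′ ∋ liftVar c k ↦ V′ ×
                    lift c (liftN (suc k) V) ≡ liftN (suc (liftVar c k)) V′)
∋-weaken insert-here x = _ , there x , refl
∋-weaken {c = suc c} {V = V} (insert-under _) here = lift c V , here , lift-comm₀ c V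
∋-weaken {c = suc c} (insert-under ins) (there {k = k} {V = V} x)
  with V′ , y , eq ← ∋-weaken ins x rewrite liftVar-suc c k
  = V′ , there y , trans (lift-comm₀ c (liftN (suc k) V)) (cong (lift 0) eq)

⇛-weaken : Insert c Γ Γ′ → Γ ⊢ X ⇛ Y → Γ′ ⊢ lift c X ⇛ lift c Y
⇛-weaken ins ⇛-sort = ⇛-sort
⇛-weaken ins ⇛-var  = ⇛-var
⇛-weaken ins (⇛-unfold x) with _ , y , eq ← ∋-weaken ins x rewrite eq = ⇛-unfold y
⇛-weaken ins (⇛-lam a b)  = ⇛-lam (⇛-weaken ins a) (⇛-weaken (insert-under ins) b)
⇛-weaken ins (⇛-abbr a b) = ⇛-abbr (⇛-weaken ins a) (⇛-weaken (insert-under ins) b)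
⇛-weaken ins (⇛-appl a b) = ⇛-appl (⇛-weaken ins a) (⇛-weaken ins b)
⇛-weaken ins (⇛-cast a b) = ⇛-cast (⇛-weaken ins a) (⇛-weaken ins b)
⇛-weaken ins (⇛-β a b)    = ⇛-β (⇛-weaken ins a) (⇛-weaken (insert-under ins) b)
⇛-weaken {c = c} ins (⇛-ζ {U = U} refl a) = ⇛-ζ (lift-comm₀ c U) (⇛-weaken ins a)
⇛-weaken ins (⇛-τ a)      = ⇛-τ (⇛-weaken ins a)
⇛-weaken {c = c} ins (⇛-υ {V₃ = V₃} a b t) rewrite lift-comm₀ c V₃ =
  ⇛-υ (⇛-weaken ins a) (⇛-weaken ins b) (⇛-weaken (insert-under ins) t)

∋-strengthen : Insert c Γ Γ′ → Γ′ ∋ k ↦ V → k ≡ liftVar c j →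
               ∃[ V₀ ] (Γ ∋ j ↦ V₀ × liftN (suc k) V ≡ lift c (liftN (suc j) V₀))
∋-strengthen insert-here (there x) refl = _ , x , refl
∋-strengthen {c = suc c} {j = zero} (insert-under {e = just V₀} _) here refl =
  V₀ , here , sym (lift-comm₀ c V₀)
∋-strengthen {c = suc c} {j = suc j} (insert-under {e = just _} _) here eq
  rewrite liftVar-suc c j with () ← eq
∋-strengthen {c = suc c} {j = suc j} (insert-under ins) (there x) eq
  rewrite liftVar-suc c j with V₀ , y , eq′ ← ∋-strengthen ins x (suc-injective eq)
  = V₀ , there y , trans (cong (lift 0) eq′) (sym (lift-comm₀ c (liftN (suc j) V₀)))

⇛-strengthen : Insert c Γ Γ′ → ∀ X → Γ′ ⊢ lift c X ⇛ Y →
               ∃[ Y₀ ] (Y ≡ lift c Y₀ × Γ ⊢ X ⇛ Y₀)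
⇛-strengthen ins (sort h) ⇛-sort = sort h , refl , ⇛-sort
⇛-strengthen ins (var j) ⇛-var  = var j , refl , ⇛-var
⇛-strengthen ins (var j) (⇛-unfold x) with V₀ , y , eq ← ∋-strengthen ins x refl =
  liftN (suc j) V₀ , eq , ⇛-unfold y
⇛-strengthen ins (lam A B) (⇛-lam a b)
  with A₀ , refl , a₀ ← ⇛-strengthen ins A a
     | B₀ , refl , b₀ ← ⇛-strengthen (insert-under ins) B b
  = lam A₀ B₀ , refl , ⇛-lam a₀ b₀
⇛-strengthen ins (abbr A B) (⇛-abbr a b) with A₀ , refl , a₀ ← ⇛-strengthen ins A a
  with B₀ , refl , b₀ ← ⇛-strengthen (insert-under ins) B b
  = abbr A₀ B₀ , refl , ⇛-abbr a₀ b₀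
⇛-strengthen ins (abbr A B) (⇛-ζ {U = U} eq u)
  with Z , refl , refl ← lift-pullback z≤n B U eq
  with Y₀ , refl , u₀ ← ⇛-strengthen ins Z u
  = Y₀ , refl , ⇛-ζ refl u₀
⇛-strengthen ins (appl A (lam W B)) (⇛-β a b)
  with A₀ , refl , a₀ ← ⇛-strengthen ins A a
     | B₀ , refl , b₀ ← ⇛-strengthen (insert-under ins) B b
  = abbr A₀ B₀ , refl , ⇛-β a₀ b₀
⇛-strengthen {c = c} ins (appl A (abbr W B)) (⇛-υ a w b)
  with A₀ , refl , a₀ ← ⇛-strengthen ins A a | W₀ , refl , w₀ ← ⇛-strengthen ins W w
  with B₀ , refl , b₀ ← ⇛-strengthen (insert-under ins) B b
  = abbr W₀ (appl (lift 0 A₀) B₀)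
  , cong (λ A₁ → abbr _ (appl A₁ _)) (sym (lift-comm₀ c A₀))
  , ⇛-υ a₀ w₀ b₀
⇛-strengthen ins (appl A B) (⇛-appl a b)
  with A₀ , refl , a₀ ← ⇛-strengthen ins A a | B₀ , refl , b₀ ← ⇛-strengthen ins B b
  = appl A₀ B₀ , refl , ⇛-appl a₀ b₀
⇛-strengthen ins (cast A B) (⇛-cast a b)
  with A₀ , refl , a₀ ← ⇛-strengthen ins A a | B₀ , refl , b₀ ← ⇛-strengthen ins B b
  = cast A₀ B₀ , refl , ⇛-cast a₀ b₀
⇛-strengthen ins (cast A B) (⇛-τ b) with B₀ , refl , b₀ ← ⇛-strengthen ins B b =
  B₀ , refl , ⇛-τ b₀

-- DevCtx Γ Γ′ Δ relates the contexts of the two steps T ⇛ S ⇛ T* of a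
-- triangle to the context Δ in which the development T* is computed.  Γ′ may
-- hold an abbreviation where Γ has a λ-binder: a β-step turns λ into δ.
data DevCtx : Ctx → Ctx → Ctx → Set where
  dev-[] : DevCtx [] [] []
  dev-λ  : DevCtx Γ Γ′ Δ → DevCtx (nothing ∷ Γ) (e ∷ Γ′) (nothing ∷ Δ)
  dev-δ  : DevCtx Γ Γ′ Δ → Γ′ ⊢ V ⇛ V* → DevCtx (just V ∷ Γ) (just V* ∷ Γ′) (just V* ∷ Δ)

devCtx-refl : DevCtx Γ Γ Γ
devCtx-refl {[]}          = dev-[]
devCtx-refl {nothing ∷ Γ} = dev-λ devCtx-refl
devCtx-refl {just V ∷ Γ}  = dev-δ devCtx-refl ⇛-refl

unfoldVar : Ctx → ℕ → Term
unfoldVar []            k       = var k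
unfoldVar (nothing ∷ Δ) zero    = var zero
unfoldVar (just V ∷ Δ)  zero    = lift 0 V
unfoldVar (_ ∷ Δ)       (suc k) = lift 0 (unfoldVar Δ k)

var⇛unfoldVar : DevCtx Γ Γ′ Δ → ∀ k → Γ′ ⊢ var k ⇛ unfoldVar Δ k
var⇛unfoldVar dev-[]      k       = ⇛-var
var⇛unfoldVar (dev-λ r)   zero    = ⇛-var
var⇛unfoldVar (dev-δ r _) zero    = ⇛-unfold here
var⇛unfoldVar (dev-λ r)   (suc k) = ⇛-weaken insert-here (var⇛unfoldVar r k)
var⇛unfoldVar (dev-δ r _) (suc k) = ⇛-weaken insert-here (var⇛unfoldVar r k)

value⇛unfoldVar : DevCtx Γ Γ′ Δ → Γ ∋ k ↦ V → Γ′ ⊢ liftN (suc k) V ⇛ unfoldVar Δ k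
value⇛unfoldVar (dev-δ r v) here      = ⇛-weaken insert-here v
value⇛unfoldVar (dev-λ r)   (there x) = ⇛-weaken insert-here (value⇛unfoldVar r x)
value⇛unfoldVar (dev-δ r _) (there x) = ⇛-weaken insert-here (value⇛unfoldVar r x)

Triangle : Ctx → Term → Term → Set
Triangle Δ T T* = ∀ {Γ Γ′ S} → DevCtx Γ Γ′ Δ → Γ ⊢ T ⇛ S → Γ′ ⊢ S ⇛ T*

triangle-sort : Triangle Δ (sort h) (sort h)
triangle-sort r ⇛-sort = ⇛-sort

triangle-var : Triangle Δ (var k) (unfoldVar Δ k)
triangle-var {k = k} r ⇛-var        = var⇛unfoldVar r k
triangle-var         r (⇛-unfold x) = value⇛unfoldVar r x

triangle-lam : Triangle Δ A A* → Triangle (nothing ∷ Δ) B B* →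
               Triangle Δ (lam A B) (lam A* B*)
triangle-lam tA tB r (⇛-lam a b) = ⇛-lam (tA r a) (tB (dev-λ r) b)

triangle-cast : Triangle Δ T T* → Triangle Δ (cast W T) T*
triangle-cast tT r (⇛-cast _ t) = ⇛-τ (tT r t)
triangle-cast tT r (⇛-τ t)      = tT r t

triangle-ζ : Triangle Δ U U* → Triangle Δ (abbr V (lift 0 U)) U*
triangle-ζ {U = U} tU r (⇛-abbr _ b) with _ , refl , u ← ⇛-strengthen insert-here U b =
  ⇛-ζ refl (tU r u)
triangle-ζ {U = U} tU r (⇛-ζ eq u) with refl ← lift-injective 0 U _ eq = tU r u

triangle-δ : ¬ IsLift 0 B → Triangle Δ V V* → Triangle (just V* ∷ Δ) B B* →
             Triangle Δ (abbr V B) (abbr V* B*)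
triangle-δ _     tV tB r (⇛-abbr v b) = ⇛-abbr (tV r v) (tB (dev-δ r (tV r v)) b)
triangle-δ ¬lift tV tB r (⇛-ζ eq _)   = ⊥-elim (¬lift (_ , eq))

triangle-β : Triangle Δ V V* → Triangle (nothing ∷ Δ) B B* →
             Triangle Δ (appl V (lam W B)) (abbr V* B*)
triangle-β tV tB r (⇛-appl v (⇛-lam _ b)) = ⇛-β (tV r v) (tB (dev-λ r) b)
triangle-β tV tB r (⇛-β v b)              = ⇛-abbr (tV r v) (tB (dev-λ r) b)

triangle-applζ : Triangle Δ V V* → Triangle Δ U U* →
                 Triangle Δ (appl V (abbr W (lift 0 U))) (appl V* U*)
triangle-applζ tV tU r (⇛-appl v t) = ⇛-appl (tV r v) (triangle-ζ tU r t)
triangle-applζ {U = U} tV tU r (⇛-υ v _ b) with _ , refl , u ← ⇛-strengthen insert-here U b =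
  ⇛-ζ refl (⇛-appl (tV r v) (tU r u))

triangle-υ : ¬ IsLift 0 B → Triangle Δ V V* → Triangle Δ W W* → Triangle (just W* ∷ Δ) B B* →
             Triangle Δ (appl V (abbr W B)) (abbr W* (appl (lift 0 V*) B*))
triangle-υ _     tV tW tB r (⇛-appl v (⇛-abbr w b)) =
  ⇛-υ (tV r v) (tW r w) (tB (dev-δ r (tW r w)) b)
triangle-υ ¬lift tV tW tB r (⇛-appl v (⇛-ζ eq _))   = ⊥-elim (¬lift (_ , eq))
triangle-υ _     tV tW tB r (⇛-υ v w b)             =
  ⇛-abbr (tW r w) (⇛-appl (⇛-weaken insert-here (tV r v)) (tB (dev-δ r (tW r w)) b))

triangle-appl : (∀ {W B} → T ≢ lam W B) → (∀ {W B} → T ≢ abbr W B) →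
                Triangle Δ V V* → Triangle Δ T T* → Triangle Δ (appl V T) (appl V* T*)
triangle-appl _    _     tV tT r (⇛-appl v t) = ⇛-appl (tV r v) (tT r t)
triangle-appl ¬lam _     _  _  r (⇛-β _ _)    = ⊥-elim (¬lam refl)
triangle-appl _    ¬abbr _  _  r (⇛-υ _ _ _)  = ⊥-elim (¬abbr refl)

-- U is not a subterm of abbr V (lift 0 U), but its development can be read off
-- that of the subterm lift 0 U under a fresh λ-binder, weakening the first step
-- and strengthening the second.
development-of-lift : Triangle (nothing ∷ Δ) (lift 0 U) B* → IsLift 0 B*
development-of-lift {U = U} tB
  with U* , refl , _ ← ⇛-strengthen insert-here U (tB (dev-λ {e = nothing} devCtx-refl) ⇛-refl) =
  U* , refl

triangle-strengthen : Triangle (nothing ∷ Δ) (lift 0 U) (lift 0 U*) → Triangle Δ U U*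
triangle-strengthen {U* = U*} tB {S = S} r u
  with _ , eq , u* ← ⇛-strengthen insert-here S
                       (tB (dev-λ {e = nothing} r) (⇛-weaken insert-here u))
  rewrite lift-injective 0 U* _ eq = u*

developable : ∀ T Δ → ∃[ T* ] Triangle Δ T T*
developable (sort h)   Δ = sort h , triangle-sort
developable (var k)    Δ = unfoldVar Δ k , triangle-var
developable (lam A B)  Δ
  with _ , tA ← developable A Δ | _ , tB ← developable B (nothing ∷ Δ) =
  _ , triangle-lam tA tB
developable (cast W T) Δ with _ , tT ← developable T Δ = _ , triangle-cast tT
developable (abbr V B) Δ with isLift? 0 B | developable B (nothing ∷ Δ)
... | yes (U , refl) | _ , tB with U* , refl ← development-of-lift tB =
  U* , triangle-ζ (triangle-strengthen tB)
... | no ¬lift | _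
  with V* , tV ← developable V Δ with _ , tB ← developable B (just V* ∷ Δ) =
  _ , triangle-δ ¬lift tV tB
developable (appl V (lam W B)) Δ
  with _ , tV ← developable V Δ | _ , tB ← developable B (nothing ∷ Δ) =
  _ , triangle-β tV tB
developable (appl V (abbr W B)) Δ
  with isLift? 0 B | developable B (nothing ∷ Δ) | developable V Δ
... | yes (U , refl) | _ , tB | _ , tV with _ , refl ← development-of-lift tB =
  _ , triangle-applζ tV (triangle-strengthen tB)
... | no ¬lift | _ | _ , tV
  with W* , tW ← developable W Δ with _ , tB ← developable B (just W* ∷ Δ) =
  _ , triangle-υ ¬lift tV tW tB
developable (appl V T@(sort _))   Δ with _ , tV ← developable V Δ | _ , tT ← developable T Δ =
  _ , triangle-appl (λ ()) (λ ()) tV tT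
developable (appl V T@(var _))    Δ with _ , tV ← developable V Δ | _ , tT ← developable T Δ =
  _ , triangle-appl (λ ()) (λ ()) tV tT
developable (appl V T@(appl _ _)) Δ with _ , tV ← developable V Δ | _ , tT ← developable T Δ =
  _ , triangle-appl (λ ()) (λ ()) tV tT
developable (appl V T@(cast _ _)) Δ with _ , tV ← developable V Δ | _ , tT ← developable T Δ =
  _ , triangle-appl (λ ()) (λ ()) tV tT

⇛-diamond : Diamond (Γ ⊢_⇛_)
⇛-diamond {Γ} {T} s₁ s₂ with T* , tT ← developable T Γ =
  T* , tT devCtx-refl s₁ , tT devCtx-refl s₂

Sub-refl : Sub i W T T
Sub-refl {T = sort h}   = s-sort
Sub-refl {T = var j}    = s-var
Sub-refl {T = lam A B}  = s-lam Sub-refl Sub-refl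
Sub-refl {T = abbr A B} = s-abbr Sub-refl Sub-refl
Sub-refl {T = appl A B} = s-appl Sub-refl Sub-refl
Sub-refl {T = cast A B} = s-cast Sub-refl Sub-refl

Sub⁺⊆Sub : Sub⁺ i W X Y → Sub i W X Y
Sub⁺⊆Sub s⁺-hit          = s-hit
Sub⁺⊆Sub (s⁺-lam₁ a b)  = s-lam (Sub⁺⊆Sub a) b
Sub⁺⊆Sub (s⁺-lam₂ a b)  = s-lam a (Sub⁺⊆Sub b)
Sub⁺⊆Sub (s⁺-abbr₁ a b) = s-abbr (Sub⁺⊆Sub a) b
Sub⁺⊆Sub (s⁺-abbr₂ a b) = s-abbr a (Sub⁺⊆Sub b)
Sub⁺⊆Sub (s⁺-appl₁ a b) = s-appl (Sub⁺⊆Sub a) b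
Sub⁺⊆Sub (s⁺-appl₂ a b) = s-appl a (Sub⁺⊆Sub b)
Sub⁺⊆Sub (s⁺-cast₁ a b) = s-cast (Sub⁺⊆Sub a) b
Sub⁺⊆Sub (s⁺-cast₂ a b) = s-cast a (Sub⁺⊆Sub b)

Sub⊆⇛ : Γ ∋ k ↦ V → Sub k (liftN (suc k) V) X Y → Γ ⊢ X ⇛ Y
Sub⊆⇛ x s-sort       = ⇛-sort
Sub⊆⇛ x s-var        = ⇛-var
Sub⊆⇛ x s-hit        = ⇛-unfold x
Sub⊆⇛ x (s-lam a b)  = ⇛-lam (Sub⊆⇛ x a) (Sub⊆⇛ (there x) b)
Sub⊆⇛ x (s-abbr a b) = ⇛-abbr (Sub⊆⇛ x a) (Sub⊆⇛ (there x) b)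
Sub⊆⇛ x (s-appl a b) = ⇛-appl (Sub⊆⇛ x a) (Sub⊆⇛ x b)
Sub⊆⇛ x (s-cast a b) = ⇛-cast (Sub⊆⇛ x a) (Sub⊆⇛ x b)

infix 4 _⊢_⇛⁺_
_⊢_⇛⁺_ : Ctx → Term → Term → Set
Γ ⊢ X ⇛⁺ Y = TransClosure (Γ ⊢_⇛_) X Y

⇛⁺-lam : Γ ⊢ A ⇛⁺ A′ → nothing ∷ Γ ⊢ B ⇛⁺ B′ → Γ ⊢ lam A B ⇛⁺ lam A′ B′
⇛⁺-lam = cong₂⁺ lam (λ a → ⇛-lam a ⇛-refl) (⇛-lam ⇛-refl)

⇛⁺-abbr : Γ ⊢ A ⇛⁺ A′ → just A′ ∷ Γ ⊢ B ⇛⁺ B′ → Γ ⊢ abbr A B ⇛⁺ abbr A′ B′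
⇛⁺-abbr = cong₂⁺ abbr (λ a → ⇛-abbr a ⇛-refl) (⇛-abbr ⇛-refl)

⇛⁺-appl : Γ ⊢ A ⇛⁺ A′ → Γ ⊢ B ⇛⁺ B′ → Γ ⊢ appl A B ⇛⁺ appl A′ B′
⇛⁺-appl = cong₂⁺ appl (λ a → ⇛-appl a ⇛-refl) (⇛-appl ⇛-refl)

⇛⁺-cast : Γ ⊢ A ⇛⁺ A′ → Γ ⊢ B ⇛⁺ B′ → Γ ⊢ cast A B ⇛⁺ cast A′ B′
⇛⁺-cast = cong₂⁺ cast (λ a → ⇛-cast a ⇛-refl) (⇛-cast ⇛-refl)

-- ⇛ cannot unfold the abbreviations it creates, so a δ-step takes two ⇛-steps.
⇒₀⊆⇛⁺ : X ⇒₀ Y → Γ ⊢ X ⇛⁺ Y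
⇒₀⊆⇛⁺ r-refl         = [ ⇛-refl ]
⇒₀⊆⇛⁺ (r-lam a b)    = ⇛⁺-lam (⇒₀⊆⇛⁺ a) (⇒₀⊆⇛⁺ b)
⇒₀⊆⇛⁺ (r-abbr a b)   = ⇛⁺-abbr (⇒₀⊆⇛⁺ a) (⇒₀⊆⇛⁺ b)
⇒₀⊆⇛⁺ (r-appl a b)   = ⇛⁺-appl (⇒₀⊆⇛⁺ a) (⇒₀⊆⇛⁺ b)
⇒₀⊆⇛⁺ (r-cast a b)   = ⇛⁺-cast (⇒₀⊆⇛⁺ a) (⇒₀⊆⇛⁺ b)
⇒₀⊆⇛⁺ (r-β v b)      =
  ⇛⁺-appl (⇒₀⊆⇛⁺ v) (⇛⁺-lam [ ⇛-refl ] (⇒₀⊆⇛⁺ b)) ∷ʳ ⇛-β ⇛-refl ⇛-refl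
⇒₀⊆⇛⁺ (r-δ v b (_ , s)) =
  ⇛⁺-abbr (⇒₀⊆⇛⁺ v) (⇒₀⊆⇛⁺ b) ∷ʳ ⇛-abbr ⇛-refl (Sub⊆⇛ here (Sub⁺⊆Sub s))
⇒₀⊆⇛⁺ (r-ζ u)        = ⇛-ζ refl ⇛-refl ∷ ⇒₀⊆⇛⁺ u
⇒₀⊆⇛⁺ (r-τ t)        = ⇛-τ ⇛-refl ∷ ⇒₀⊆⇛⁺ t
⇒₀⊆⇛⁺ (r-υ v w t)    =
  ⇛⁺-appl (⇒₀⊆⇛⁺ v) (⇛⁺-abbr (⇒₀⊆⇛⁺ w) (⇒₀⊆⇛⁺ t)) ∷ʳ ⇛-υ ⇛-refl ⇛-refl ⇛-refl

-- The environment-dependent step, with the environment read as a context.  The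
-- freshness half of the strict substitution is dropped: it always holds
-- (∉FV-liftN).
infix 4 _⊢_↝_
data _⊢_↝_ (Γ : Ctx) (X Y : Term) : Set where
  ↝-free   : X ⇒₀ Y → Γ ⊢ X ↝ Y
  ↝-unfold : Γ ∋ k ↦ V → X ⇒₀ Z → Sub⁺ k (liftN (suc k) V) Z Y → Γ ⊢ X ↝ Y

infix 4 _⊢_↝⁺_
_⊢_↝⁺_ : Ctx → Term → Term → Set
Γ ⊢ X ↝⁺ Y = TransClosure (Γ ⊢_↝_) X Y

↝⊆⇛⁺ : Γ ⊢ X ↝ Y → Γ ⊢ X ⇛⁺ Y
↝⊆⇛⁺ (↝-free r)       = ⇒₀⊆⇛⁺ r
↝⊆⇛⁺ (↝-unfold x r s) = ⇒₀⊆⇛⁺ r ∷ʳ Sub⊆⇛ x (Sub⁺⊆Sub s)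

↝-lamˡ : Γ ⊢ A ↝ A′ → Γ ⊢ lam A B ↝ lam A′ B
↝-lamˡ (↝-free a)       = ↝-free (r-lam a r-refl)
↝-lamˡ (↝-unfold x a s) = ↝-unfold x (r-lam a r-refl) (s⁺-lam₁ s Sub-refl)

↝-lamʳ : nothing ∷ Γ ⊢ B ↝ B′ → Γ ⊢ lam A B ↝ lam A B′
↝-lamʳ (↝-free b)               = ↝-free (r-lam r-refl b)
↝-lamʳ (↝-unfold (there x) b s) = ↝-unfold x (r-lam r-refl b) (s⁺-lam₂ Sub-refl s)

↝-abbrˡ : Γ ⊢ A ↝ A′ → Γ ⊢ abbr A B ↝ abbr A′ B
↝-abbrˡ (↝-free a)       = ↝-free (r-abbr a r-refl)
↝-abbrˡ (↝-unfold x a s) = ↝-unfold x (r-abbr a r-refl) (s⁺-abbr₁ s Sub-refl)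

↝-abbrʳ : just A ∷ Γ ⊢ B ↝ B′ → Γ ⊢ abbr A B ↝ abbr A B′
↝-abbrʳ         (↝-free b)               = ↝-free (r-abbr r-refl b)
↝-abbrʳ {A = A} (↝-unfold here b s)      = ↝-free (r-δ r-refl b (∉FV-liftN 0 A , s))
↝-abbrʳ         (↝-unfold (there x) b s) = ↝-unfold x (r-abbr r-refl b) (s⁺-abbr₂ Sub-refl s)

↝-applˡ : Γ ⊢ A ↝ A′ → Γ ⊢ appl A B ↝ appl A′ B
↝-applˡ (↝-free a)       = ↝-free (r-appl a r-refl)
↝-applˡ (↝-unfold x a s) = ↝-unfold x (r-appl a r-refl) (s⁺-appl₁ s Sub-refl)

↝-applʳ : Γ ⊢ B ↝ B′ → Γ ⊢ appl A B ↝ appl A B′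
↝-applʳ (↝-free b)       = ↝-free (r-appl r-refl b)
↝-applʳ (↝-unfold x b s) = ↝-unfold x (r-appl r-refl b) (s⁺-appl₂ Sub-refl s)

↝-castˡ : Γ ⊢ A ↝ A′ → Γ ⊢ cast A B ↝ cast A′ B
↝-castˡ (↝-free a)       = ↝-free (r-cast a r-refl)
↝-castˡ (↝-unfold x a s) = ↝-unfold x (r-cast a r-refl) (s⁺-cast₁ s Sub-refl)

↝-castʳ : Γ ⊢ B ↝ B′ → Γ ⊢ cast A B ↝ cast A B′
↝-castʳ (↝-free b)       = ↝-free (r-cast r-refl b)
↝-castʳ (↝-unfold x b s) = ↝-unfold x (r-cast r-refl b) (s⁺-cast₂ Sub-refl s)

⇛⊆↝⁺ : Γ ⊢ X ⇛ Y → Γ ⊢ X ↝⁺ Y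
⇛⊆↝⁺ ⇛-sort         = [ ↝-free r-refl ]
⇛⊆↝⁺ ⇛-var          = [ ↝-free r-refl ]
⇛⊆↝⁺ (⇛-unfold x)   = [ ↝-unfold x r-refl s⁺-hit ]
⇛⊆↝⁺ (⇛-lam a b)    = cong₂⁺ lam ↝-lamˡ ↝-lamʳ (⇛⊆↝⁺ a) (⇛⊆↝⁺ b)
⇛⊆↝⁺ (⇛-abbr a b)   = cong₂⁺ abbr ↝-abbrˡ ↝-abbrʳ (⇛⊆↝⁺ a) (⇛⊆↝⁺ b)
⇛⊆↝⁺ (⇛-appl a b)   = cong₂⁺ appl ↝-applˡ ↝-applʳ (⇛⊆↝⁺ a) (⇛⊆↝⁺ b)
⇛⊆↝⁺ (⇛-cast a b)   = cong₂⁺ cast ↝-castˡ ↝-castʳ (⇛⊆↝⁺ a) (⇛⊆↝⁺ b)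
⇛⊆↝⁺ (⇛-β v b)      =
  cong₂⁺ (λ V B → appl V (lam _ B)) ↝-applˡ (↝-applʳ ∘ ↝-lamʳ) (⇛⊆↝⁺ v) (⇛⊆↝⁺ b)
  ∷ʳ ↝-free (r-β r-refl r-refl)
⇛⊆↝⁺ (⇛-ζ refl u)   = ↝-free (r-ζ r-refl) ∷ ⇛⊆↝⁺ u
⇛⊆↝⁺ (⇛-τ t)        = ↝-free (r-τ r-refl) ∷ ⇛⊆↝⁺ t
⇛⊆↝⁺ (⇛-υ v w t)    =
  cong₂⁺ appl ↝-applˡ ↝-applʳ (⇛⊆↝⁺ v) (cong₂⁺ abbr ↝-abbrˡ ↝-abbrʳ (⇛⊆↝⁺ w) (⇛⊆↝⁺ t))
  ∷ʳ ↝-free (r-υ r-refl r-refl r-refl)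

-- An environment lists its items outermost first, a context innermost first.
envCtx : Env → Ctx
envCtx (e-sort h)   = []
envCtx (e-lam W C)  = envCtx C List.∷ʳ nothing
envCtx (e-abbr V C) = envCtx C List.∷ʳ just V
envCtx (e-appl V C) = envCtx C
envCtx (e-cast W C) = envCtx C

length-envCtx : ∀ C → length (envCtx C) ≡ binders C
length-envCtx (e-sort h)   = refl
length-envCtx (e-lam W C)  =
  trans (length-++ (envCtx C)) (trans (+-comm _ 1) (cong suc (length-envCtx C)))
length-envCtx (e-abbr V C) =
  trans (length-++ (envCtx C)) (trans (+-comm _ 1) (cong suc (length-envCtx C)))
length-envCtx (e-appl V C) = length-envCtx C
length-envCtx (e-cast W C) = length-envCtx C

∋-∷ʳ : Γ ∋ k ↦ V → Γ List.∷ʳ e ∋ k ↦ V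
∋-∷ʳ here      = here
∋-∷ʳ (there x) = there (∋-∷ʳ x)

∋-last : ∀ Γ → Γ List.∷ʳ just V ∋ length Γ ↦ V
∋-last []      = here
∋-last (_ ∷ Γ) = there (∋-last Γ)

∋-∷ʳ⁻ : ∀ Γ → Γ List.∷ʳ e ∋ k ↦ V → Γ ∋ k ↦ V ⊎ (k ≡ length Γ × e ≡ just V)
∋-∷ʳ⁻ []           here      = inj₂ (refl , refl)
∋-∷ʳ⁻ (just _ ∷ Γ) here      = inj₁ here
∋-∷ʳ⁻ (_ ∷ Γ)      (there x) with ∋-∷ʳ⁻ Γ x
... | inj₁ y            = inj₁ (there y)
... | inj₂ (refl , e≡V) = inj₂ (refl , e≡V)

envCtx-∋ : ∀ C₁ {C₂} → envCtx (C₁ ·δ V · C₂) ∋ binders C₂ ↦ V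
envCtx-∋ {V = V} (e-sort h) {C₂} =
  subst (λ k → envCtx C₂ List.∷ʳ just V ∋ k ↦ V) (length-envCtx C₂) (∋-last (envCtx C₂))
envCtx-∋ (e-lam W C₁)  = ∋-∷ʳ (envCtx-∋ C₁)
envCtx-∋ (e-abbr W C₁) = ∋-∷ʳ (envCtx-∋ C₁)
envCtx-∋ (e-appl W C₁) = envCtx-∋ C₁
envCtx-∋ (e-cast W C₁) = envCtx-∋ C₁

envCtx-∋⁻ : ∀ C → envCtx C ∋ k ↦ V →
            ∃[ C₁ ] ∃[ C₂ ] (C ≡ (C₁ ·δ V · C₂) × k ≡ binders C₂)
envCtx-∋⁻ (e-lam W C) x with ∋-∷ʳ⁻ (envCtx C) x
... | inj₁ y with C₁ , C₂ , refl , eq ← envCtx-∋⁻ C y = e-lam W C₁ , C₂ , refl , eq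
envCtx-∋⁻ (e-abbr V C) x with ∋-∷ʳ⁻ (envCtx C) x
... | inj₁ y with C₁ , C₂ , refl , eq ← envCtx-∋⁻ C y = e-abbr V C₁ , C₂ , refl , eq
... | inj₂ (refl , refl) = e-sort 0 , C , refl , length-envCtx C
envCtx-∋⁻ (e-appl W C) x with C₁ , C₂ , refl , eq ← envCtx-∋⁻ C x =
  e-appl W C₁ , C₂ , refl , eq
envCtx-∋⁻ (e-cast W C) x with C₁ , C₂ , refl , eq ← envCtx-∋⁻ C x =
  e-cast W C₁ , C₂ , refl , eq

⇒⊆↝ : ∀ C → C ⊢ X ⇒ Y → envCtx C ⊢ X ↝ Y
⇒⊆↝ C (inj₁ r)                                     = ↝-free r
⇒⊆↝ C (inj₂ (C₁ , C₂ , V , Z , refl , r , (_ , s))) = ↝-unfold (envCtx-∋ C₁) r s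

↝⊆⇒ : ∀ C → envCtx C ⊢ X ↝ Y → C ⊢ X ⇒ Y
↝⊆⇒ C (↝-free r) = inj₁ r
↝⊆⇒ C (↝-unfold {k = k} {V = V} {Z = Z} x r s) with C₁ , C₂ , eq , refl ← envCtx-∋⁻ C x =
  inj₂ (C₁ , C₂ , V , Z , eq , r , (∉FV-liftN k V , s))

mainTheorem2 : (C : Env) (T₀ T₁ T₂ : Term) →
    C ⊢ T₀ ⇒* T₁ → C ⊢ T₀ ⇒* T₂ →
    ∃[ T ] ((C ⊢ T₁ ⇒* T) × (C ⊢ T₂ ⇒* T))
mainTheorem2 C _ _ _ =
  diamond⁺-transfer (↝⊆⇛⁺ ∘ ⇒⊆↝ C) (map⁺ id (↝⊆⇒ C) ∘ ⇛⊆↝⁺) ⇛-diamond
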